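{- Let $\tau,\sigma$ be increasing words of positive integers such that the concatenation $\tau\sigma$ is a reduced word. Then the word $\mathrm{lift}(\tau\sigma)$ is Coxeter–Knuth equivalent to $\tau\sigma$.
   Context: Reduced words: a word $(\rho_\ell,\ldots,\rho_1)$ of positive integers ($\rho_\ell$ leftmost) is reduced if $s_{\rho_\ell}\cdots s_{\rho_1}$ is a permutation with exactly $\ell$ inversions ($s_i=(i\ i{+}1)$). Coxeter–Knuth equivalence. For $\rho=(\rho_m,\ldots,\rho_1)$: $\mathfrak c_j$ ($1\le j<m$) swaps $\rho_j,\rho_{j+1}$ if $|\rho_j-\rho_{j+1}|>1$, else identity; $\mathfrak b_j$ ($1<j<m$) replaces $\rho_{j+1}\rho_j\rho_{j-1}$ by $\rho_j\rho_{j+1}\rho_j$ if $\rho_{j+1}=\rho_{j-1}$, else identity. $\mathfrak d_i(\rho)$ ($1<i<m$) is $\mathfrak b_i(\rho)$ if $\rho_{i+1}=\rho_{i-1}=\rho_i\pm1$; $\mathfrak c_{i-1}(\rho)$ if $\rho_{i-1}>\rho_{i+1}>\rho_i$ or $\rho_{i-1}<\rho_{i+1}<\rho_i$; $\mathfrak c_i(\rho)$ if $\rho_{i+1}>\rho_{i-1}>\rho_i$ or $\rho_{i+1}<\rho_{i-1}<\rho_i$; $\rho$ otherwise. Coxeter–Knuth equivalence is the equivalence relation generated by the $\mathfrak d_i$. Lift. Increasing words are written left to right, $\tau=\tau_1\cdots\tau_t$ with $\tau_1<\cdots<\tau_t$ and $\sigma=\sigma_1\cdots\sigma_s$. The lift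 alignment of $\tau$ above $\sigma$ is defined recursively: if $\tau_{t-i+1}\ge\sigma_{s-i+1}$ for all $1\le i\le\min(s,t)$, place $\tau_{t-i+1}$ directly above $\sigma_{s-i+1}$ for all such $i$ (right justification); otherwise, with $i_1$ the least index such that $\tau_{t-i_1+1}<\sigma_{s-i_1+1}$, place $\tau_{t-i_1+2},\ldots,\tau_t$ directly above $\sigma_{s-i_1+2},\ldots,\sigma_s$, put nothing above $\sigma_{s-i_1+1}$, and align $\tau_1\cdots\tau_{t-i_1+1}$ above $\sigma_1\cdots\sigma_{s-i_1}$ recursively. Let $x_1,\ldots,x_k$ be, left to right, the letters of $\sigma$ with no letter of $\tau$ above them. This gives factorizations into consecutive, possibly empty, segments $\sigma=\sigma^{(1)}x_1\sigma^{(2)}\cdots x_k\sigma^{(k+1)}$ and $\tau=\tau^{(0)}\tau^{(1)}\cdots\tau^{(k+1)}$, where $\tau^{(j)}$ ($1\le j\le k+1$) lies directly above $\sigma^{(j)}$ and $\tau^{(0)}$ consists of the letters of $\tau$ to the left of all letters of $\sigma$. Then $\mathrm{lift}(\tau\sigma)$ is the word $\tau^{(0)}\tau^{(1)}x_1\tau^{(2)}\cdots x_k\tau^{(k+1)}\,\sigma^{(1)}\check\sigma^{(2)}\cdots\check\sigma^{(k+1)}$, where for $1\le j\le k$, $\check\sigma^{(j+1)}_i=\sigma^{(j+1)}_i-1$ for $1\le i\le b_j$ and $\check\sigma^{(j+1)}_i=\sigma^{(j+1)}_i$ for $i>b_j$, with $b_j=\max\{b\ge0:\tau^{(j+1)}_i=\sigma^{(j+1)}_i=x_j+i\text{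 for all }1\le i\le b\}$ if $x_j=\sigma^{(j+1)}_1-1$, and $b_j=0$ otherwise. -}

module Defs where

open import Data.Bool using (Bool; true; false; if_then_else_; _∧_; _∨_)
open import Data.Nat using (ℕ; zero; suc; _+_; _∸_; _⊔_; _≡ᵇ_; _<ᵇ_; _≤ᵇ_)
open import Data.List using (List; []; _∷_; _++_; length; map; concatMap; reverse; foldr)
open import Data.Maybe using (Maybe; just; nothing)
open import Data.Product using (_×_; _,_; proj₁; proj₂)
open import Function using (id; _∘_)
open import Relation.Binary.Construct.Closure.Equivalence using (EqClosure)

-- Words are lists of naturals written LEFT TO RIGHT.  A word
-- (ρ_m , … , ρ_1) in the paper (ρ_m leftmost) is the list ρ_m ∷ … ∷ ρ_1 ∷ [].

s : ℕ → ℕ → ℕ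
s k i = if i ≡ᵇ k then suc k else (if i ≡ᵇ suc k then k else i)

perm : List ℕ → ℕ → ℕ
perm []      = id
perm (a ∷ w) = s a ∘ perm w

range1 : ℕ → List ℕ
range1 zero    = []
range1 (suc n) = range1 n ++ (suc n ∷ [])

countAbove : (ℕ → ℕ) → ℕ → List ℕ → ℕ
countAbove w i []      = 0
countAbove w i (j ∷ js) =
  (if (i <ᵇ j) ∧ (w j <ᵇ w i) then 1 else 0) + countAbove w i js

inversions : (ℕ → ℕ) → ℕ → ℕ
inversions w n = foldr (λ i acc → countAbove w i (range1 n) + acc) 0 (range1 n)

maxLetter : List ℕ → ℕ
maxLetter = foldr _⊔_ 0

-- a word ρ of positive letters is reduced iff its permutation (which only
-- moves 1 .. maxLetter ρ + 1) has exactly length ρ inversions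
Reduced : List ℕ → Set
Reduced ρ = inversions (perm ρ) (suc (maxLetter ρ)) ≡ length ρ
  where open import Relation.Binary.PropositionalEquality using (_≡_)

farApart : ℕ → ℕ → Bool
farApart p q = (suc p <ᵇ q) ∨ (suc q <ᵇ p)

-- the action of 𝔡_i on the three letters  x = ρ_{i+1}, y = ρ_i, z = ρ_{i-1}
-- (written left to right); the other letters are unchanged.
dLocal : ℕ → ℕ → ℕ → List ℕ
dLocal x y z =
  if (x ≡ᵇ z) ∧ ((x ≡ᵇ suc y) ∨ (suc x ≡ᵇ y))
    then y ∷ x ∷ y ∷ []
  else if ((x <ᵇ z) ∧ (y <ᵇ x)) ∨ ((z <ᵇ x) ∧ (x <ᵇ y))
    then (if farApart y z then x ∷ z ∷ y ∷ [] else x ∷ y ∷ z ∷ [])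
  else if ((z <ᵇ x) ∧ (y <ᵇ z)) ∨ ((x <ᵇ z) ∧ (z <ᵇ y))
    then (if farApart x y then y ∷ x ∷ z ∷ [] else x ∷ y ∷ z ∷ [])
  else x ∷ y ∷ z ∷ []

data DStep : List ℕ → List ℕ → Set where
  dstep : ∀ (l : List ℕ) (x y z : ℕ) (r : List ℕ) →
          DStep (l ++ x ∷ y ∷ z ∷ r) (l ++ dLocal x y z ++ r)

CKEquiv : List ℕ → List ℕ → Set
CKEquiv = EqClosure DStep

-- Arguments are reverse τ and
-- reverse σ; the result is (reverse of) σ annotated with the letter of τ
-- directly above each letter (nothing = no letter above), together with the
-- reverse of τ^(0) (the letters of τ left of all of σ).
-- This is the recursive definition unrolled: right-justified pairs are
-- matched until the first failing index i₁, σ_{s-i₁+1} gets nothing, and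
-- the alignment restarts on τ_1⋯τ_{t-i₁+1} above σ_1⋯σ_{s-i₁}.
align : List ℕ → List ℕ → List (Maybe ℕ × ℕ) × List ℕ
align rt       []       = [] , rt
align []       (b ∷ rs) = let (p , q) = align [] rs in (nothing , b) ∷ p , q
align (a ∷ rt) (b ∷ rs) =
  if b ≤ᵇ a
    then (let (p , q) = align rt rs in (just a , b) ∷ p , q)
    else (let (p , q) = align (a ∷ rt) rs in (nothing , b) ∷ p , q)

-- factor the annotated σ (left to right) as
--   σ^(1) x_1 σ^(2) ⋯ x_k σ^(k+1)
-- returning (pairs of σ^(1) with τ^(1) above) and the list of
-- (x_j , pairs of σ^(j+1) with τ^(j+1) above).  Pairs are (τ-letter , σ-letter).
segments : List (Maybe ℕ × ℕ) → List (ℕ × ℕ) × List (ℕ × List (ℕ × ℕ))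
segments []                  = [] , []
segments ((just a  , b) ∷ r) = let (g , rest) = segments r in (a , b) ∷ g , rest
segments ((nothing , b) ∷ r) = let (g , rest) = segments r in [] , (b , g) ∷ rest

runLen : ℕ → ℕ → List (ℕ × ℕ) → ℕ
runLen x i []            = 0
runLen x i ((a , c) ∷ g) =
  if (a ≡ᵇ x + i) ∧ (c ≡ᵇ x + i) then suc (runLen x (suc i) g) else 0

bj : ℕ → List (ℕ × ℕ) → ℕ
bj x []              = 0
bj x ((a , c) ∷ g)   = if suc x ≡ᵇ c then runLen x 1 ((a , c) ∷ g) else 0

decFirst : ℕ → List ℕ → List ℕ
decFirst zero    w       = w
decFirst (suc b) []      = []
decFirst (suc b) (c ∷ w) = (c ∸ 1) ∷ decFirst b w

check : ℕ × List (ℕ × ℕ) → List ℕ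
check (x , g) = decFirst (bj x g) (map proj₂ g)

lift : List ℕ → List ℕ → List ℕ
lift τ σ =
  let (ann , rτ0) = align (reverse τ) (reverse σ)
      (g1 , rest) = segments (reverse ann)
  in  reverse rτ0 ++ map proj₁ g1
        ++ concatMap (λ xg → proj₁ xg ∷ map proj₁ (proj₂ xg)) rest
        ++ map proj₂ g1 ++ concatMap check rest

-- Write τ = a τ′.  Since the alignment reads τ from the right and a is
-- the smallest letter of τ, aligning a τ′ above σ means aligning τ′ and then a alone
-- against the letters of σ that τ′ left uncovered.  Either a finds nothing (it joins
-- τ⁽⁰⁾, and lift(aτ′σ) is literally a · lift(τ′σ)), or it fills the empty column above
-- some b ≤ a.  If b < a, then b moves from the top row of a · lift(τ′σ) to the bottom row,
-- and this is achieved by Knuth moves inside the increasing rows.  If b = a, the word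
-- a · lift(τ′σ) contains a ⋯ a with only smaller letters between, so reducedness forces
-- the letter x just left of b in σ to be a − 1; a braid move then produces the letter
-- a − 1 of the bottom row that the lift creates by decrementing b.  Reducedness passes
-- from τσ to a · lift(τ′σ) through the induction hypothesis, because Coxeter–Knuth moves
-- preserve both the permutation and the length, and a reduced word has as many
-- inversions as letters while s_a ∘ f has at most one more inversion than f.

module Submission where

open import Defs
open import Data.Bool using (true; false; if_then_else_; _∧_; _∨_; T)
open import Data.Bool.Properties using (T-∧; T-∨; ∧-zeroʳ; ∨-zeroʳ)
open import Data.Empty using (⊥-elim)
open import Data.List using (List; []; _∷_; _++_; length; map; concatMap; reverse; _ʳ++_; foldr; initLast; _∷ʳ′_)
open import Data.List.Properties
  using (++-assoc; ++-identityʳ; ++-conicalʳ; length-++; length-++-sucʳ; map-++; reverse-++; unfold-reverse; reverse-map; reverse-involutive)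
open import Data.List.Relation.Unary.All using (All; []; _∷_)
import Data.List.Relation.Unary.All as All
import Data.List.Relation.Unary.All.Properties as All
open import Data.List.Relation.Unary.AllPairs using (_∷_)
open import Data.List.Relation.Unary.Linked using (Linked; []; [-]; _∷_)
import Data.List.Relation.Unary.Linked as Linked
open import Data.List.Relation.Unary.Linked.Properties using (Linked⇒AllPairs)
open import Data.Maybe using (Maybe; just; nothing)
open import Data.Nat using (ℕ; zero; suc; _+_; _*_; _⊔_; _≡ᵇ_; _<ᵇ_; _≤ᵇ_; _<_; _≤_; _>_; z≤n; s≤s)
open import Data.Nat.Properties
open import Algebra.Properties.CommutativeSemigroup +-commutativeSemigroup using () renaming (interchange to +-interchange)
open import Data.Product using (_×_; _,_; proj₁; proj₂; map₁)
open import Data.Sum using (_⊎_; inj₁; inj₂)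
open import Data.Unit using (tt)
open import Function using (_∘_; flip)
open import Function.Bundles using (Equivalence)
open import Function.Definitions using (Injective)
open import Relation.Binary.Construct.Closure.ReflexiveTransitive using (ε; _◅◅_)
import Relation.Binary.Construct.Closure.Equivalence as EqClosure
open import Relation.Binary.Definitions using (Transitive)
open import Relation.Binary.PropositionalEquality
open import Relation.Nullary using (¬_; yes; no; contradiction; ofʸ; ofⁿ)

T-true : ∀ {b} → b ≡ true → T b
T-true refl = tt

≡ᵇ-true : ∀ {m n} → m ≡ n → (m ≡ᵇ n) ≡ true
≡ᵇ-true {m} {n} m≡n with m ≡ᵇ n in eq
... | true  = refl
... | false = contradiction (≡⇒≡ᵇ m n m≡n) (subst T eq)

≡ᵇ-false : ∀ {m n} → m ≢ n → (m ≡ᵇ n) ≡ false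
≡ᵇ-false {m} {n} m≢n with m ≡ᵇ n in eq
... | false = refl
... | true  = contradiction (≡ᵇ⇒≡ m n (T-true eq)) m≢n

<ᵇ-true : ∀ {m n} → m < n → (m <ᵇ n) ≡ true
<ᵇ-true {m} {n} m<n with m <ᵇ n in eq
... | true  = refl
... | false = contradiction (<⇒<ᵇ m<n) (subst T eq)

<ᵇ-false : ∀ {m n} → n ≤ m → (m <ᵇ n) ≡ false
<ᵇ-false {m} {n} n≤m with m <ᵇ n in eq
... | false = refl
... | true  = contradiction n≤m (<⇒≱ (<ᵇ⇒< m n (T-true eq)))

s-suc : ∀ k i → s (suc k) (suc i) ≡ suc (s k i)
s-suc k i with i ≡ᵇ k
... | true  = refl
... | false with i ≡ᵇ suc k
...   | true  = refl
...   | false = refl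

s-involutive : ∀ k i → s k (s k i) ≡ i
s-involutive zero    zero          = refl
s-involutive zero    (suc zero)    = refl
s-involutive zero    (suc (suc i)) = refl
s-involutive (suc k) zero          = refl
s-involutive (suc k) (suc i)
  rewrite s-suc k i | s-suc k (s k i) = cong suc (s-involutive k i)

s-injective : ∀ k {i j} → s k i ≡ s k j → i ≡ j
s-injective k {i} {j} eq = begin
  i           ≡⟨ sym (s-involutive k i) ⟩
  s k (s k i) ≡⟨ cong (s k) eq ⟩
  s k (s k j) ≡⟨ s-involutive k j ⟩
  j           ∎
  where open ≡-Reasoning

s-comm-< : ∀ a b i → suc a < b → s a (s b i) ≡ s b (s a i)
s-comm-< zero    (suc zero)    _             (s≤s ())
s-comm-< zero    (suc (suc b)) zero          _ = refl
s-comm-< zero    (suc (suc b)) (suc zero)    _ = refl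
s-comm-< zero    (suc (suc b)) (suc (suc i)) _
  rewrite s-suc (suc b) (suc i) | s-suc b i = refl
s-comm-< (suc a) (suc b)       zero          _ = refl
s-comm-< (suc a) (suc b)       (suc i)       (s≤s 1+a<b)
  rewrite s-suc b i | s-suc a i | s-suc a (s b i) | s-suc b (s a i) =
  cong suc (s-comm-< a b i 1+a<b)

FarApart : ℕ → ℕ → Set
FarApart p q = suc p < q ⊎ suc q < p

s-comm : ∀ a b i → FarApart a b → s a (s b i) ≡ s b (s a i)
s-comm a b i (inj₁ 1+a<b) = s-comm-< a b i 1+a<b
s-comm a b i (inj₂ 1+b<a) = sym (s-comm-< b a i 1+b<a)

s-braid : ∀ a i → s a (s (suc a) (s a i)) ≡ s (suc a) (s a (s (suc a) i))
s-braid zero    zero                      = refl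
s-braid zero    (suc zero)                = refl
s-braid zero    (suc (suc zero))          = refl
s-braid zero    (suc (suc (suc zero)))    = refl
s-braid zero    (suc (suc (suc (suc i)))) = refl
s-braid (suc a) zero                      = refl
s-braid (suc a) (suc i)
  rewrite s-suc a i | s-suc (suc a) (s a i) | s-suc a (s (suc a) (s a i))
        | s-suc (suc a) i | s-suc a (s (suc a) i) | s-suc (suc a) (s a (s (suc a) i)) =
  cong suc (s-braid a i)

-- Coxeter–Knuth moves preserve the permutation and the length

data DLocalShape (x y z : ℕ) : List ℕ → Set where
  unchanged  : DLocalShape x y z (x ∷ y ∷ z ∷ [])
  swap-right : FarApart y z → DLocalShape x y z (x ∷ z ∷ y ∷ [])
  swap-left  : FarApart x y → DLocalShape x y z (y ∷ x ∷ z ∷ [])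
  braid-down : x ≡ z → x ≡ suc y → DLocalShape x y z (y ∷ x ∷ y ∷ [])
  braid-up   : x ≡ z → suc x ≡ y → DLocalShape x y z (y ∷ x ∷ y ∷ [])

farApart⇒FarApart : ∀ p q → farApart p q ≡ true → FarApart p q
farApart⇒FarApart p q far with Equivalence.to T-∨ (T-true far)
... | inj₁ 1+p<q = inj₁ (<ᵇ⇒< (suc p) q 1+p<q)
... | inj₂ 1+q<p = inj₂ (<ᵇ⇒< (suc q) p 1+q<p)

dLocalShape : ∀ x y z → DLocalShape x y z (dLocal x y z)
dLocalShape x y z with (x ≡ᵇ z) ∧ ((x ≡ᵇ suc y) ∨ (suc x ≡ᵇ y)) in isBraid
... | true with Equivalence.to T-∧ (T-true isBraid)
...   | x≡z , x≡1+y∨1+x≡y with Equivalence.to T-∨ x≡1+y∨1+x≡y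
...     | inj₁ x≡1+y = braid-down (≡ᵇ⇒≡ x z x≡z) (≡ᵇ⇒≡ x (suc y) x≡1+y)
...     | inj₂ 1+x≡y = braid-up (≡ᵇ⇒≡ x z x≡z) (≡ᵇ⇒≡ (suc x) y 1+x≡y)
dLocalShape x y z | false with ((x <ᵇ z) ∧ (y <ᵇ x)) ∨ ((z <ᵇ x) ∧ (x <ᵇ y))
... | true with farApart y z in far
...   | true  = swap-right (farApart⇒FarApart y z far)
...   | false = unchanged
dLocalShape x y z | false | false with ((z <ᵇ x) ∧ (y <ᵇ z)) ∨ ((x <ᵇ z) ∧ (z <ᵇ y))
... | true with farApart x y in far
...   | true  = swap-left (farApart⇒FarApart x y far)
...   | false = unchanged
dLocalShape x y z | false | false | false = unchanged

perm-++ : ∀ u v i → perm (u ++ v) i ≡ perm u (perm v i)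
perm-++ []      v i = refl
perm-++ (a ∷ u) v i = cong (s a) (perm-++ u v i)

perm-dLocal : ∀ x y z i → perm (dLocal x y z) i ≡ perm (x ∷ y ∷ z ∷ []) i
perm-dLocal x y z i with dLocal x y z | dLocalShape x y z
... | _ | unchanged        = refl
... | _ | swap-right y↔z   = cong (s x) (sym (s-comm y z i y↔z))
... | _ | swap-left x↔y    = sym (s-comm x y (s z i) x↔y)
perm-dLocal x y .x i | _ | braid-down refl refl = s-braid y i
perm-dLocal x y .x i | _ | braid-up refl refl   = sym (s-braid x i)

length-dLocal : ∀ x y z → length (dLocal x y z) ≡ 3
length-dLocal x y z with dLocal x y z | dLocalShape x y z
... | _ | unchanged      = refl
... | _ | swap-right _   = refl
... | _ | swap-left _    = refl
... | _ | braid-down _ _ = refl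
... | _ | braid-up _ _   = refl

DStep-perm : ∀ {u v} → DStep u v → ∀ i → perm u i ≡ perm v i
DStep-perm (dstep l x y z r) i = begin
  perm (l ++ x ∷ y ∷ z ∷ r) i               ≡⟨ perm-++ l _ i ⟩
  perm l (perm (x ∷ y ∷ z ∷ []) (perm r i)) ≡⟨ cong (perm l) (sym (perm-dLocal x y z (perm r i))) ⟩
  perm l (perm (dLocal x y z) (perm r i))   ≡⟨ cong (perm l) (sym (perm-++ (dLocal x y z) r i)) ⟩
  perm l (perm (dLocal x y z ++ r) i)       ≡⟨ sym (perm-++ l _ i) ⟩
  perm (l ++ dLocal x y z ++ r) i           ∎
  where open ≡-Reasoning

DStep-length : ∀ {u v} → DStep u v → length u ≡ length v
DStep-length (dstep l x y z r) = begin
  length (l ++ x ∷ y ∷ z ∷ r)                   ≡⟨ length-++ l ⟩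
  length l + (3 + length r)                     ≡⟨ cong (λ n → length l + (n + length r)) (sym (length-dLocal x y z)) ⟩
  length l + (length (dLocal x y z) + length r) ≡⟨ cong (length l +_) (sym (length-++ (dLocal x y z))) ⟩
  length l + length (dLocal x y z ++ r)         ≡⟨ sym (length-++ l) ⟩
  length (l ++ dLocal x y z ++ r)               ∎
  where open ≡-Reasoning

CK-perm : ∀ {u v} → CKEquiv u v → ∀ i → perm u i ≡ perm v i
CK-perm u~v i = EqClosure.gfold isEquivalence (λ w → perm w i) (λ st → DStep-perm st i) u~v

CK-length : ∀ {u v} → CKEquiv u v → length u ≡ length v
CK-length = EqClosure.gfold isEquivalence length DStep-length

-- Counting inversions

sumOver : (ℕ → ℕ) → List ℕ → ℕ
sumOver h = foldr (λ i acc → h i + acc) 0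

sumOver-++ : ∀ h A B → sumOver h (A ++ B) ≡ sumOver h A + sumOver h B
sumOver-++ h []      B = refl
sumOver-++ h (a ∷ A) B = trans (cong (h a +_) (sumOver-++ h A B)) (sym (+-assoc (h a) _ _))

sumOver-cong : ∀ {h g} L → All (λ i → h i ≡ g i) L → sumOver h L ≡ sumOver g L
sumOver-cong []      []         = refl
sumOver-cong (i ∷ L) (hi≡gi ∷ eqs) = cong₂ _+_ hi≡gi (sumOver-cong L eqs)

sumOver-zero : ∀ {h} L → All (λ i → h i ≡ 0) L → sumOver h L ≡ 0
sumOver-zero []      []         = refl
sumOver-zero (i ∷ L) (hi≡0 ∷ eqs) = cong₂ _+_ hi≡0 (sumOver-zero L eqs)

sumOver-mono : ∀ {h g} L → (∀ i → h i ≤ g i) → sumOver h L ≤ sumOver g L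
sumOver-mono []      h≤g = z≤n
sumOver-mono (i ∷ L) h≤g = +-mono-≤ (h≤g i) (sumOver-mono L h≤g)

sumOver-+ : ∀ h g L → sumOver (λ i → h i + g i) L ≡ sumOver h L + sumOver g L
sumOver-+ h g []      = refl
sumOver-+ h g (i ∷ L) = trans (cong (h i + g i +_) (sumOver-+ h g L)) (+-interchange (h i) (g i) _ _)

sumOver-product : ∀ g h L M → sumOver (λ i → sumOver (λ j → g i * h j) M) L ≡ sumOver g L * sumOver h M
sumOver-product g h []      M = refl
sumOver-product g h (i ∷ L) M = begin
  sumOver (λ j → g i * h j) M + sumOver (λ i → sumOver (λ j → g i * h j) M) L
    ≡⟨ cong₂ _+_ (sumOver-*ˡ M) (sumOver-product g h L M) ⟩
  g i * sumOver h M + sumOver g L * sumOver h M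
    ≡⟨ sym (*-distribʳ-+ (sumOver h M) (g i) _) ⟩
  (g i + sumOver g L) * sumOver h M
    ∎
  where
  open ≡-Reasoning
  sumOver-*ˡ : ∀ M → sumOver (λ j → g i * h j) M ≡ g i * sumOver h M
  sumOver-*ˡ []      = sym (*-zeroʳ (g i))
  sumOver-*ˡ (j ∷ M) = trans (cong (g i * h j +_) (sumOver-*ˡ M)) (sym (*-distribˡ-+ (g i) (h j) _))

inverted : (ℕ → ℕ) → ℕ → ℕ → ℕ
inverted f i j = if (i <ᵇ j) ∧ (f j <ᵇ f i) then 1 else 0

inversions-sumOver : ∀ f n → inversions f n ≡ sumOver (λ i → sumOver (inverted f i) (range1 n)) (range1 n)
inversions-sumOver f n = sumOver-cong (range1 n) (All.universal (λ i → row i (range1 n)) (range1 n))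
  where
  row : ∀ i L → countAbove f i L ≡ sumOver (inverted f i) L
  row i []      = refl
  row i (j ∷ L) = cong (inverted f i j +_) (row i L)

inversions-cong : ∀ {f g} n → (∀ i → f i ≡ g i) → inversions f n ≡ inversions g n
inversions-cong {f} {g} n f≗g = begin
  inversions f n                                            ≡⟨ inversions-sumOver f n ⟩
  sumOver (λ i → sumOver (inverted f i) (range1 n)) (range1 n)
    ≡⟨ sumOver-cong (range1 n) (All.universal (λ i → sumOver-cong (range1 n) (All.universal (entry i) _)) _) ⟩
  sumOver (λ i → sumOver (inverted g i) (range1 n)) (range1 n) ≡⟨ sym (inversions-sumOver g n) ⟩
  inversions g n                                            ∎
  where
  open ≡-Reasoning
  entry : ∀ i j → inverted f i j ≡ inverted g i j
  entry i j rewrite f≗g i | f≗g j = refl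

sumOver-snoc : ∀ h L x → sumOver h (L ++ x ∷ []) ≡ sumOver h L + h x
sumOver-snoc h L x = trans (sumOver-++ h L (x ∷ [])) (cong (sumOver h L +_) (+-identityʳ (h x)))

range1-≤ : ∀ n → All (_≤ n) (range1 n)
range1-≤ zero    = []
range1-≤ (suc n) = All.++⁺ (All.map m≤n⇒m≤1+n (range1-≤ n)) (≤-refl ∷ [])

PermutesUpTo : ℕ → (ℕ → ℕ) → Set
PermutesUpTo N f = f (suc N) ≡ suc N × (∀ i → i ≤ N → f i ≤ N)

inversions-suc : ∀ {N f} → PermutesUpTo N f → inversions f (suc N) ≡ inversions f N
inversions-suc {N} {f} (fixes-1+N , bounded) = begin
  inversions f (suc N)                                        ≡⟨ inversions-sumOver f (suc N) ⟩
  sumOver (λ i → row i (range1 (suc N))) (range1 N ++ suc N ∷ []) ≡⟨ sumOver-snoc _ (range1 N) (suc N) ⟩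
  sumOver (λ i → row i (range1 (suc N))) (range1 N) + row (suc N) (range1 (suc N))
    ≡⟨ cong₂ _+_ (sumOver-cong (range1 N) (All.map drop-last-column (range1-≤ N)))
                 (sumOver-zero (range1 (suc N)) (All.map last-row-zero (range1-≤ (suc N)))) ⟩
  sumOver (λ i → row i (range1 N)) (range1 N) + 0             ≡⟨ +-identityʳ _ ⟩
  sumOver (λ i → row i (range1 N)) (range1 N)                 ≡⟨ sym (inversions-sumOver f N) ⟩
  inversions f N                                              ∎
  where
  open ≡-Reasoning
  row : ℕ → List ℕ → ℕ
  row i = sumOver (inverted f i)
  drop-last-column : ∀ {i} → i ≤ N → row i (range1 (suc N)) ≡ row i (range1 N)
  drop-last-column {i} i≤N
    rewrite sumOver-snoc (inverted f i) (range1 N) (suc N) | fixes-1+N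
          | <ᵇ-false {suc N} {f i} (m≤n⇒m≤1+n (bounded i i≤N)) | ∧-zeroʳ (i <ᵇ suc N) = +-identityʳ _
  last-row-zero : ∀ {j} → j ≤ suc N → inverted f (suc N) j ≡ 0
  last-row-zero j≤1+N rewrite <ᵇ-false j≤1+N = refl

inversions-stable : ∀ {B f} → (∀ N → B ≤ N → PermutesUpTo N f) →
                    ∀ N → B ≤ N → inversions f N ≡ inversions f B
inversions-stable P zero    z≤n = refl
inversions-stable P (suc N) B≤1+N with m≤n⇒m<n∨m≡n B≤1+N
... | inj₂ refl       = refl
... | inj₁ (s≤s B≤N) = trans (inversions-suc (P N B≤N)) (inversions-stable P N B≤N)

s-≤ : ∀ {k i N} → suc k ≤ N → i ≤ N → s k i ≤ N
s-≤ {zero}  {zero}        1≤N _   = 1≤N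
s-≤ {zero}  {suc zero}    _   _   = z≤n
s-≤ {zero}  {suc (suc i)} _   i≤N = i≤N
s-≤ {suc k} {zero}        _   _   = z≤n
s-≤ {suc k} {suc i} (s≤s 1+k≤N) (s≤s i≤N) rewrite s-suc k i = s≤s (s-≤ 1+k≤N i≤N)

s-fixes-above : ∀ {k i} → suc k < i → s k i ≡ i
s-fixes-above {zero}  {suc zero}    (s≤s ())
s-fixes-above {zero}  {suc (suc i)} _ = refl
s-fixes-above {suc k} {suc i} (s≤s 1+k<i) rewrite s-suc k i = cong suc (s-fixes-above 1+k<i)

permutesUpTo-perm : ∀ w {N} → suc (maxLetter w) ≤ N → PermutesUpTo N (perm w)
permutesUpTo-perm []      _   = refl , λ _ i≤N → i≤N
permutesUpTo-perm (a ∷ w) w<N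
  with permutesUpTo-perm w (≤-trans (s≤s (m≤n⊔m a (maxLetter w))) w<N)
... | fixes , bounded =
  trans (cong (s a) fixes) (s-fixes-above (s≤s a<N)) , λ i i≤N → s-≤ a<N (bounded i i≤N)
  where
  a<N = ≤-trans (s≤s (m≤m⊔n a (maxLetter w))) w<N

inversions-perm-stable : ∀ w {N} → suc (maxLetter w) ≤ N →
                         inversions (perm w) N ≡ inversions (perm w) (suc (maxLetter w))
inversions-perm-stable w = inversions-stable (λ N → permutesUpTo-perm w) _

δ : ℕ → ℕ → ℕ
δ b x = if x ≡ᵇ b then 1 else 0

s-reverses : ∀ a u v → s a v < s a u → v < u ⊎ (u ≡ a × v ≡ suc a)
s-reverses zero    zero          zero          (s≤s ())
s-reverses zero    zero          (suc zero)    _          = inj₂ (refl , refl)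
s-reverses zero    zero          (suc (suc v)) (s≤s ())
s-reverses zero    (suc (suc u)) zero          _          = inj₁ (s≤s z≤n)
s-reverses zero    (suc (suc u)) (suc zero)    _          = inj₁ (s≤s (s≤s z≤n))
s-reverses zero    (suc (suc u)) (suc (suc v)) v<u        = inj₁ v<u
s-reverses (suc a) (suc u)       zero          _          = inj₁ (s≤s z≤n)
s-reverses (suc a) (suc u)       (suc v)       v<u
  rewrite s-suc a v | s-suc a u with s-reverses a u v (≤-pred v<u)
... | inj₁ v<u′          = inj₁ (s≤s v<u′)
... | inj₂ (refl , refl) = inj₂ (refl , refl)

inverted-s∘ : ∀ a f i j → inverted (s a ∘ f) i j ≤ inverted f i j + δ a (f i) * δ (suc a) (f j)
inverted-s∘ a f i j with i <ᵇ j
... | false = z≤n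
... | true with s a (f j) <ᵇ s a (f i) in reversed
...   | false = z≤n
...   | true with s-reverses a (f i) (f j) (<ᵇ⇒< _ _ (T-true reversed))
...     | inj₁ fj<fi rewrite <ᵇ-true fj<fi = s≤s z≤n
...     | inj₂ (fi≡a , fj≡1+a) rewrite ≡ᵇ-true fi≡a | ≡ᵇ-true fj≡1+a = m≤n+m 1 _

occurrences-≤1 : ∀ {f} → Injective _≡_ _≡_ f → ∀ b N → sumOver (λ i → δ b (f i)) (range1 N) ≤ 1
occurrences-≤1 f-inj b zero = z≤n
occurrences-≤1 {f} f-inj b (suc N) rewrite sumOver-snoc (λ i → δ b (f i)) (range1 N) (suc N)
  with f (suc N) ≡ᵇ b in hit
... | false = subst (_≤ 1) (sym (+-identityʳ _)) (occurrences-≤1 f-inj b N)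
... | true  = ≤-reflexive (cong (_+ 1) (sumOver-zero (range1 N) (All.map missed (range1-≤ N))))
  where
  f[1+N]≡b : f (suc N) ≡ b
  f[1+N]≡b = ≡ᵇ⇒≡ _ _ (T-true hit)
  missed : ∀ {i} → i ≤ N → δ b (f i) ≡ 0
  missed {i} i≤N rewrite ≡ᵇ-false {f i} {b} (λ fi≡b → <⇒≢ (s≤s i≤N) (f-inj (trans fi≡b (sym f[1+N]≡b)))) = refl

inversions-s∘ : ∀ a {f} → Injective _≡_ _≡_ f → ∀ N → inversions (s a ∘ f) N ≤ suc (inversions f N)
inversions-s∘ a {f} f-inj N = begin
  inversions (s a ∘ f) N
    ≡⟨ inversions-sumOver (s a ∘ f) N ⟩
  sumOver (λ i → sumOver (inverted (s a ∘ f) i) R) R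
    ≤⟨ sumOver-mono R (λ i → sumOver-mono R (inverted-s∘ a f i)) ⟩
  sumOver (λ i → sumOver (λ j → inverted f i j + pair i j) R) R
    ≡⟨ sumOver-cong R (All.universal (λ i → sumOver-+ (inverted f i) (pair i) R) R) ⟩
  sumOver (λ i → sumOver (inverted f i) R + sumOver (pair i) R) R
    ≡⟨ sumOver-+ _ _ R ⟩
  inversionSum + sumOver (λ i → sumOver (pair i) R) R
    ≡⟨ cong (inversionSum +_) (sumOver-product _ _ R R) ⟩
  inversionSum + occurrences a * occurrences (suc a)
    ≤⟨ +-monoʳ-≤ inversionSum (*-mono-≤ (occurrences-≤1 f-inj a N) (occurrences-≤1 f-inj (suc a) N)) ⟩
  inversionSum + 1
    ≡⟨ +-comm inversionSum 1 ⟩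
  suc inversionSum
    ≡⟨ cong suc (sym (inversions-sumOver f N)) ⟩
  suc (inversions f N)
    ∎
  where
  open ≤-Reasoning
  R = range1 N
  pair : ℕ → ℕ → ℕ
  pair i j = δ a (f i) * δ (suc a) (f j)
  occurrences : ℕ → ℕ
  occurrences b = sumOver (λ i → δ b (f i)) R
  inversionSum = sumOver (λ i → sumOver (inverted f i) R) R

perm-injective : ∀ w → Injective _≡_ _≡_ (perm w)
perm-injective []      eq = eq
perm-injective (a ∷ w) eq = perm-injective w (s-injective a eq)

inversions-perm-≤ : ∀ w N → inversions (perm w) N ≤ length w
inversions-perm-≤ []      N = ≤-reflexive (trans (inversions-sumOver (λ i → i) N) (sumOver-zero R (All.universal row-zero R)))
  where
  R = range1 N
  identity-sorted : ∀ i j → inverted (λ k → k) i j ≡ 0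
  identity-sorted i j with i <ᵇ j in i<j
  ... | false = refl
  ... | true rewrite <ᵇ-false {j} {i} (<⇒≤ (<ᵇ⇒< i j (T-true i<j))) = refl
  row-zero : ∀ i → sumOver (inverted (λ k → k) i) R ≡ 0
  row-zero i = sumOver-zero R (All.universal (identity-sorted i) R)
inversions-perm-≤ (a ∷ w) N = ≤-trans (inversions-s∘ a (perm-injective w) N) (s≤s (inversions-perm-≤ w N))

Reduced-at : ∀ w {N} → suc (maxLetter w) ≤ N → Reduced w → inversions (perm w) N ≡ length w
Reduced-at w w<N reduced = trans (inversions-perm-stable w w<N) reduced

Reduced-tail : ∀ a w → Reduced (a ∷ w) → Reduced w
Reduced-tail a w reduced = ≤-antisym (inversions-perm-≤ w (suc (maxLetter w))) (≤-pred (begin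
  suc (length w)                                ≡⟨ sym (Reduced-at (a ∷ w) ≤-refl reduced) ⟩
  inversions (s a ∘ perm w) N                   ≤⟨ inversions-s∘ a (perm-injective w) N ⟩
  suc (inversions (perm w) N)                   ≡⟨ cong suc (inversions-perm-stable w (s≤s (m≤n⊔m a (maxLetter w)))) ⟩
  suc (inversions (perm w) (suc (maxLetter w))) ∎))
  where
  open ≤-Reasoning
  N = suc (a ⊔ maxLetter w)

Reduced-respects-CK : ∀ {u v} → CKEquiv u v → Reduced u → Reduced v
Reduced-respects-CK {u} {v} u~v reduced = begin
  inversions (perm v) (suc (maxLetter v)) ≡⟨ sym (inversions-perm-stable v (m≤n⊔m (suc (maxLetter u)) _)) ⟩
  inversions (perm v) N                   ≡⟨ inversions-cong N (λ i → sym (CK-perm u~v i)) ⟩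
  inversions (perm u) N                   ≡⟨ Reduced-at u (m≤m⊔n _ (suc (maxLetter v))) reduced ⟩
  length u                                ≡⟨ CK-length u~v ⟩
  length v                                ∎
  where
  open ≡-Reasoning
  N = suc (maxLetter u) ⊔ suc (maxLetter v)

length-twice-inserted : ∀ (l : List ℕ) a m r → length (l ++ a ∷ m ++ a ∷ r) ≡ 2 + length (l ++ m ++ r)
length-twice-inserted l a m r = begin
  length (l ++ a ∷ m ++ a ∷ r)     ≡⟨ length-++-sucʳ l a (m ++ a ∷ r) ⟩
  suc (length (l ++ m ++ a ∷ r))   ≡⟨ cong (suc ∘ length) (sym (++-assoc l m (a ∷ r))) ⟩
  suc (length ((l ++ m) ++ a ∷ r)) ≡⟨ cong suc (length-++-sucʳ (l ++ m) a r) ⟩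
  2 + length ((l ++ m) ++ r)       ≡⟨ cong ((2 +_) ∘ length) (++-assoc l m r) ⟩
  2 + length (l ++ m ++ r)         ∎
  where open ≡-Reasoning

perm-far : ∀ {a} m i → All (FarApart a) m → perm m (s a i) ≡ s a (perm m i)
perm-far []      i []              = refl
perm-far (b ∷ m) i (a↔b ∷ far) = trans (cong (s b) (perm-far m i far)) (sym (s-comm _ b (perm m i) a↔b))

¬Reduced-repeat : ∀ l a m r → All (FarApart a) m → ¬ Reduced (l ++ a ∷ m ++ a ∷ r)
¬Reduced-repeat l a m r far reduced = 1+n≰n (≤-trans (n≤1+n _) (begin
  2 + length short          ≡⟨ sym (length-twice-inserted l a m r) ⟩
  length long               ≡⟨ sym (Reduced-at long ≤-refl reduced) ⟩
  inversions (perm long) N  ≡⟨ inversions-cong N (λ i → sym (same-perm i)) ⟩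
  inversions (perm short) N ≤⟨ inversions-perm-≤ short N ⟩
  length short              ∎))
  where
  open ≤-Reasoning
  long = l ++ a ∷ m ++ a ∷ r
  short = l ++ m ++ r
  N = suc (maxLetter long)
  same-perm : ∀ i → perm short i ≡ perm long i
  same-perm i = begin-equality
    perm (l ++ m ++ r) i                   ≡⟨ perm-++ l _ i ⟩
    perm l (perm (m ++ r) i)               ≡⟨ cong (perm l) (perm-++ m r i) ⟩
    perm l (perm m (perm r i))             ≡⟨ cong (perm l ∘ perm m) (sym (s-involutive a _)) ⟩
    perm l (perm m (s a (s a (perm r i)))) ≡⟨ cong (perm l) (perm-far m _ far) ⟩
    perm l (s a (perm m (s a (perm r i)))) ≡⟨ cong (perm l ∘ s a) (sym (perm-++ m (a ∷ r) i)) ⟩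
    perm l (s a (perm (m ++ a ∷ r) i))     ≡⟨ sym (perm-++ l _ i) ⟩
    perm long i                            ∎

module _ {A : Set} {R : A → A → Set} where

  Linked-++⁻ˡ : ∀ L {M} → Linked R (L ++ M) → Linked R L
  Linked-++⁻ˡ []          _          = []
  Linked-++⁻ˡ (x ∷ [])    _          = [-]
  Linked-++⁻ˡ (x ∷ y ∷ L) (Rxy ∷ lk) = Rxy ∷ Linked-++⁻ˡ (y ∷ L) lk

  Linked-++⁻ʳ : ∀ L {M} → Linked R (L ++ M) → Linked R M
  Linked-++⁻ʳ []      lk = lk
  Linked-++⁻ʳ (x ∷ L) lk = Linked-++⁻ʳ L (Linked.tail lk)

  Linked-ʳ++ : ∀ {x} xs {acc} → Linked R (x ∷ xs) → Linked (flip R) (x ∷ acc) →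
               Linked (flip R) (xs ʳ++ x ∷ acc)
  Linked-ʳ++ []       _          lk-acc = lk-acc
  Linked-ʳ++ (y ∷ xs) (Rxy ∷ lk) lk-acc = Linked-ʳ++ xs lk (Rxy ∷ lk-acc)

  Linked-reverse : ∀ {xs} → Linked R xs → Linked (flip R) (reverse xs)
  Linked-reverse {[]}     _  = []
  Linked-reverse {x ∷ xs} lk = Linked-ʳ++ xs lk [-]

  Linked-∷⁺ : ∀ {x xs} → All (R x) xs → Linked R xs → Linked R (x ∷ xs)
  Linked-∷⁺ []        _  = [-]
  Linked-∷⁺ (Rxy ∷ _) lk = Rxy ∷ lk

  Linked-head-All : Transitive R → ∀ {x xs} → Linked R (x ∷ xs) → All (R x) xs
  Linked-head-All trans lk with Linked⇒AllPairs trans lk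
  ... | Rx-xs ∷ _ = Rx-xs

All-reverse : ∀ {A : Set} {P : A → Set} {xs} → All P xs → All P (reverse xs)
All-reverse {P = P} {xs} pxs = go xs [] pxs []
  where
  go : ∀ xs acc → All P xs → All P acc → All P (xs ʳ++ acc)
  go []       acc []         p-acc = p-acc
  go (x ∷ xs) acc (px ∷ pxs) p-acc = go xs (x ∷ acc) pxs (px ∷ p-acc)

Linked-<-All : ∀ {x xs} → Linked _<_ (x ∷ xs) → All (x <_) xs
Linked-<-All = Linked-head-All <-trans

Linked-<-init : ∀ L {x r} → Linked _<_ (L ++ x ∷ r) → All (_< x) L
Linked-<-init []      _  = []
Linked-<-init (y ∷ L) lk = All.head (All.++⁻ʳ L (Linked-<-All lk)) ∷ Linked-<-init L (Linked.tail lk)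

-- Coxeter–Knuth moves on increasing words

CK-++ˡ : ∀ p {u v} → CKEquiv u v → CKEquiv (p ++ u) (p ++ v)
CK-++ˡ p = EqClosure.gmap (p ++_) step
  where
  step : ∀ {u v} → DStep u v → DStep (p ++ u) (p ++ v)
  step (dstep l x y z r) = subst₂ DStep (++-assoc p l _) (++-assoc p l _) (dstep (p ++ l) x y z r)

CK-∷ : ∀ a {u v} → CKEquiv u v → CKEquiv (a ∷ u) (a ∷ v)
CK-∷ a = CK-++ˡ (a ∷ [])

CK-dLocal : ∀ {x y z w} r → dLocal x y z ≡ w → CKEquiv (x ∷ y ∷ z ∷ r) (w ++ r)
CK-dLocal {x} {y} {z} r refl = EqClosure.return (dstep [] x y z r)

farApart-< : ∀ {a c} → suc a < c → farApart a c ≡ true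
farApart-< 1+a<c rewrite <ᵇ-true 1+a<c = refl

farApart-> : ∀ {a c} → suc c < a → farApart a c ≡ true
farApart-> {a} {c} 1+c<a rewrite <ᵇ-true 1+c<a = ∨-zeroʳ (suc a <ᵇ c)

dLocal-knuth-left : ∀ {a b c} → a < b → b < c → dLocal c a b ≡ a ∷ c ∷ b ∷ []
dLocal-knuth-left {a} {b} {c} a<b b<c
  rewrite ≡ᵇ-false (>⇒≢ b<c) | <ᵇ-false (<⇒≤ b<c) | <ᵇ-true b<c | <ᵇ-false (<⇒≤ (<-trans a<b b<c))
        | <ᵇ-true a<b | farApart-> (≤-trans (s≤s a<b) b<c) = refl

dLocal-knuth-right : ∀ {a b c} → a < b → b < c → dLocal b a c ≡ b ∷ c ∷ a ∷ []
dLocal-knuth-right {a} {b} {c} a<b b<c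
  rewrite ≡ᵇ-false (<⇒≢ b<c) | <ᵇ-true b<c | <ᵇ-true a<b | farApart-< (≤-trans (s≤s a<b) b<c) = refl

dLocal-braid : ∀ a → dLocal (suc a) a (suc a) ≡ a ∷ suc a ∷ a ∷ []
dLocal-braid a rewrite ≡ᵇ-true {a} refl = refl

CK-sink : ∀ {c v} U r → Linked _<_ (U ++ v ∷ []) → v < c → CKEquiv (c ∷ U ++ v ∷ r) (U ++ c ∷ v ∷ r)
CK-sink []               r _                 _   = ε
CK-sink (u ∷ [])         r (u<v ∷ _)         v<c = CK-dLocal r (dLocal-knuth-left u<v v<c)
CK-sink (u ∷ u′ ∷ U) r (u<u′ ∷ increasing) v<c =
  CK-dLocal (U ++ _ ∷ r) (dLocal-knuth-left u<u′ (<-trans (All.head (Linked-<-init (u′ ∷ U) increasing)) v<c))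
  ◅◅ CK-∷ u (CK-sink (u′ ∷ U) r increasing v<c)

CK-bubble : ∀ {b y} W r → y < b → Linked _<_ (b ∷ W) → CKEquiv (b ∷ y ∷ W ++ r) (b ∷ W ++ y ∷ r)
CK-bubble []      r _   _                = ε
CK-bubble (w ∷ W) r y<b (b<w ∷ increasing) =
  CK-dLocal (W ++ r) (dLocal-knuth-right y<b b<w) ◅◅ CK-∷ _ (CK-bubble W r (<-trans y<b b<w) increasing)

CK-insert : ∀ {a b} L W r → Linked _<_ (L ++ b ∷ []) → b < a → Linked _<_ (a ∷ W) →
            CKEquiv (a ∷ L ++ b ∷ W ++ r) (L ++ a ∷ W ++ b ∷ r)
CK-insert L W r L<b b<a aW = CK-sink L (W ++ r) L<b b<a ◅◅ CK-++ˡ L (CK-bubble W r b<a aW)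

CK-insert-braid : ∀ {x} L W r → Linked _<_ (L ++ x ∷ []) → Linked _<_ (suc x ∷ W) →
                  CKEquiv (suc x ∷ L ++ x ∷ suc x ∷ W ++ r) (L ++ x ∷ suc x ∷ W ++ x ∷ r)
CK-insert-braid {x} L W r L<x xW =
  CK-sink L (suc x ∷ W ++ r) L<x (n<1+n x)
  ◅◅ CK-++ˡ L (CK-dLocal (W ++ r) (dLocal-braid x) ◅◅ CK-∷ x (CK-bubble W r (n<1+n x) xW))

-- The two rows of the lift

Column : Set
Column = Maybe ℕ × ℕ

top : Column → ℕ
top (just a  , _) = a
top (nothing , b) = b

blank : List ℕ → List Column
blank = map (nothing ,_)

topRowOf : List (ℕ × ℕ) × List (ℕ × List (ℕ × ℕ)) → List ℕ
topRowOf (g , rest) = map proj₁ g ++ concatMap (λ xg → proj₁ xg ∷ map proj₁ (proj₂ xg)) rest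

checks : ℕ → List (ℕ × ℕ) × List (ℕ × List (ℕ × ℕ)) → List ℕ
checks x (g , rest) = check (x , g) ++ concatMap check rest

bottomRow : List Column → List ℕ
bottomRow Y = map proj₂ (proj₁ (segments Y)) ++ concatMap check (proj₂ (segments Y))

rows : List Column → List ℕ
rows Y = map top Y ++ bottomRow Y

alignedTops : List Column × List ℕ → List ℕ
alignedTops (ann , rτ₀) = map top ann ++ rτ₀

liftAligned : List Column × List ℕ → List ℕ
liftAligned (ann , rτ₀) = reverse rτ₀ ++ rows (reverse ann)

topRow-segments : ∀ Y → topRowOf (segments Y) ≡ map top Y
topRow-segments []                  = refl
topRow-segments ((just a  , b) ∷ Y) = cong (a ∷_) (topRow-segments Y)
topRow-segments ((nothing , b) ∷ Y) = cong (b ∷_) (topRow-segments Y)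

lift-liftAligned : ∀ τ σ → lift τ σ ≡ liftAligned (align (reverse τ) (reverse σ))
lift-liftAligned τ σ = cong (reverse (proj₂ AL) ++_) (begin
  map proj₁ (proj₁ SG) ++ tops ++ bottomRow Y ≡⟨ sym (++-assoc (map proj₁ (proj₁ SG)) tops (bottomRow Y)) ⟩
  topRowOf SG ++ bottomRow Y                  ≡⟨ cong (_++ bottomRow Y) (topRow-segments Y) ⟩
  rows Y                                      ∎)
  where
  open ≡-Reasoning
  AL = align (reverse τ) (reverse σ)
  Y  = reverse (proj₁ AL)
  SG = segments Y
  tops = concatMap (λ xg → proj₁ xg ∷ map proj₁ (proj₂ xg)) (proj₂ SG)

checks-blank : ∀ c L x Y → checks c (segments (blank (L ++ x ∷ []) ++ Y)) ≡ checks x (segments Y)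
checks-blank c []      x Y = refl
checks-blank c (d ∷ L) x Y = checks-blank d L x Y

bottomRow-blank-∷ʳ : ∀ L x Y → bottomRow (blank (L ++ x ∷ []) ++ Y) ≡ checks x (segments Y)
bottomRow-blank-∷ʳ []      x Y = refl
bottomRow-blank-∷ʳ (d ∷ L) x Y = checks-blank d L x Y

bottomRow-blank : ∀ K → bottomRow (blank K) ≡ []
bottomRow-blank []      = refl
bottomRow-blank (c ∷ K) = checks-empty c K
  where
  checks-empty : ∀ c K → checks c (segments (blank K)) ≡ []
  checks-empty c []      = refl
  checks-empty c (d ∷ K) = checks-empty d K

runLen-shift : ∀ x i g → runLen x (suc i) g ≡ runLen (suc x) i g
runLen-shift x i []            = refl
runLen-shift x i ((a , c) ∷ g) rewrite +-suc x i with (a ≡ᵇ suc (x + i)) ∧ (c ≡ᵇ suc (x + i))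
... | true  = cong suc (runLen-shift x (suc i) g)
... | false = refl

runLen-1 : ∀ x a b g →
           runLen x 1 ((a , b) ∷ g) ≡ (if (a ≡ᵇ suc x) ∧ (b ≡ᵇ suc x) then suc (runLen x 2 g) else 0)
runLen-1 x a b g rewrite +-comm x 1 = refl

bj-runLen : ∀ x g → bj x g ≡ runLen x 1 g
bj-runLen x []            = refl
bj-runLen x ((a , b) ∷ g) with suc x ≡ᵇ b in 1+x≡b
... | true  = refl
... | false rewrite runLen-1 x a b g
                  | ≡ᵇ-false {b} {suc x} (λ b≡1+x → subst T 1+x≡b (≡⇒≡ᵇ (suc x) b (sym b≡1+x)))
                  | ∧-zeroʳ (a ≡ᵇ suc x) = refl

check-unchanged : ∀ x a b g → a ≢ suc x ⊎ b ≢ suc x → check (x , (a , b) ∷ g) ≡ b ∷ map proj₂ g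
check-unchanged x a b g no-run rewrite bj-runLen x ((a , b) ∷ g) | runLen-1 x a b g with no-run
... | inj₁ a≢1+x rewrite ≡ᵇ-false a≢1+x = refl
... | inj₂ b≢1+x rewrite ≡ᵇ-false b≢1+x | ∧-zeroʳ (a ≡ᵇ suc x) = refl

check-run : ∀ x g → check (x , (suc x , suc x) ∷ g) ≡ x ∷ check (suc x , g)
check-run x g rewrite bj-runLen x ((suc x , suc x) ∷ g) | runLen-1 x (suc x) (suc x) g | ≡ᵇ-true {x} refl
                    | runLen-shift x 1 g | bj-runLen (suc x) g = refl

check-first-segment : ∀ {a b} Y → b < a → All (λ p → a < top p) Y →
                      check (b , proj₁ (segments Y)) ≡ map proj₂ (proj₁ (segments Y))
check-first-segment []                  _   _         = refl
check-first-segment ((nothing , c) ∷ Y) _   _         = refl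
check-first-segment ((just t  , c) ∷ Y) b<a (a<t ∷ _) =
  check-unchanged _ t c _ (inj₁ λ t≡1+b → <⇒≱ b<a (≤-pred (subst (_ <_) t≡1+b a<t)))

bottomRow-fill-< : ∀ L {a b} Y → b < a → All (λ p → a < top p) Y →
                   bottomRow (blank L ++ (just a , b) ∷ Y) ≡ b ∷ bottomRow (blank L ++ (nothing , b) ∷ Y)
bottomRow-fill-< L {a} {b} Y b<a a<Y with initLast L
... | [] = cong (b ∷_) (cong (_++ concatMap check (proj₂ (segments Y))) (sym (check-first-segment Y b<a a<Y)))
... | L′ ∷ʳ′ x rewrite bottomRow-blank-∷ʳ L′ x ((just a , b) ∷ Y) | bottomRow-blank-∷ʳ L′ x ((nothing , b) ∷ Y) =
  trans (cong (_++ rest) (check-unchanged x a b _ no-run))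
        (cong (λ v → b ∷ v ++ rest) (sym (check-first-segment Y b<a a<Y)))
  where
  rest = concatMap check (proj₂ (segments Y))
  no-run : a ≢ suc x ⊎ b ≢ suc x
  no-run with a ≟ suc x
  ... | yes a≡1+x = inj₂ λ b≡1+x → >⇒≢ b<a (trans a≡1+x (sym b≡1+x))
  ... | no a≢1+x  = inj₁ a≢1+x

bottomRow-fill-braid : ∀ L x Y → bottomRow (blank (L ++ x ∷ []) ++ (just (suc x) , suc x) ∷ Y)
                                 ≡ x ∷ bottomRow (blank (L ++ x ∷ []) ++ (nothing , suc x) ∷ Y)
bottomRow-fill-braid L x Y
  rewrite bottomRow-blank-∷ʳ L x ((just (suc x) , suc x) ∷ Y)
        | bottomRow-blank-∷ʳ L x ((nothing , suc x) ∷ Y) =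
  cong (_++ concatMap check (proj₂ (segments Y))) (check-run x (proj₁ (segments Y)))

top-blank : ∀ K → map top (blank K) ≡ K
top-blank []      = refl
top-blank (c ∷ K) = cong (c ∷_) (top-blank K)

map-top-blank : ∀ L Z → map top (blank L ++ Z) ≡ L ++ map top Z
map-top-blank []      Z = refl
map-top-blank (c ∷ L) Z = cong (c ∷_) (map-top-blank L Z)

rows-blank : ∀ L p Y → rows (blank L ++ p ∷ Y) ≡ L ++ top p ∷ map top Y ++ bottomRow (blank L ++ p ∷ Y)
rows-blank L p Y = trans (cong (_++ bottomRow (blank L ++ p ∷ Y)) (map-top-blank L (p ∷ Y))) (++-assoc L _ _)

rows-fill : ∀ L {a b} Y → Linked _<_ (L ++ b ∷ []) → b ≤ a → Linked _<_ (a ∷ map top Y) →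
            Reduced (a ∷ rows (blank L ++ (nothing , b) ∷ Y)) →
            CKEquiv (rows (blank L ++ (just a , b) ∷ Y)) (a ∷ rows (blank L ++ (nothing , b) ∷ Y))
rows-fill L {a} {b} Y L<b b≤a aW reduced
  rewrite rows-blank L (just a , b) Y | rows-blank L (nothing , b) Y
  with m≤n⇒m<n∨m≡n b≤a
... | inj₁ b<a rewrite bottomRow-fill-< L Y b<a (All.map⁻ (Linked-<-All aW)) =
  EqClosure.symmetric _ (CK-insert L (map top Y) _ L<b b<a aW)
... | inj₂ refl with initLast L
...   | [] = ⊥-elim (¬Reduced-repeat [] b [] (map top Y ++ bottomRow ((nothing , b) ∷ Y)) [] reduced)
...   | L′ ∷ʳ′ x with suc x ≟ b
...     | yes refl rewrite bottomRow-fill-braid L′ x Y =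
  subst₂ CKEquiv (sym (++-assoc L′ _ _)) (cong (suc x ∷_) (sym (++-assoc L′ _ _)))
    (EqClosure.symmetric _ (CK-insert-braid L′ (map top Y) _ (Linked-++⁻ˡ (L′ ++ x ∷ []) L<b) aW))
...     | no 1+x≢b = ⊥-elim (¬Reduced-repeat [] b (L′ ++ x ∷ []) _ far reduced)
  where
  below-b : All (_< b) (L′ ++ x ∷ [])
  below-b = Linked-<-init (L′ ++ x ∷ []) L<b
  1+x<b : suc x < b
  1+x<b = ≤∧≢⇒< (All.head (All.++⁻ʳ L′ below-b)) 1+x≢b
  far : All (FarApart b) (L′ ++ x ∷ [])
  far = All.++⁺ (All.map (λ y<x → inj₂ (<-trans (s≤s y<x) 1+x<b))
                         (Linked-<-init L′ (Linked-++⁻ˡ (L′ ++ x ∷ []) L<b)))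
                (inj₂ 1+x<b ∷ [])

-- The lift alignment

record PartialAlignment : Set where
  constructor partial
  field
    columns      : List Column
    unusedTop    : List ℕ
    unusedBottom : List ℕ
open PartialAlignment

_◂_ : Column → PartialAlignment → PartialAlignment
c ◂ partial cs t b = partial (c ∷ cs) t b

alignPrefix : List ℕ → List ℕ → PartialAlignment
alignPrefix rt       []       = partial [] rt []
alignPrefix []       (b ∷ rs) = partial [] [] (b ∷ rs)
alignPrefix (a ∷ rt) (b ∷ rs) =
  if b ≤ᵇ a then (just a , b) ◂ alignPrefix rt rs else (nothing , b) ◂ alignPrefix (a ∷ rt) rs

align-[] : ∀ S → align [] S ≡ (blank S , [])
align-[] []      = refl
align-[] (b ∷ S) rewrite align-[] S = refl

align-++ : ∀ rt u rs → let P = alignPrefix rt rs; A = align u (unusedBottom P) in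
           align (rt ++ u) rs ≡ (columns P ++ proj₁ A , unusedTop P ++ proj₂ A)
align-++ rt       u []       = refl
align-++ []       u (b ∷ rs) = refl
align-++ (a ∷ rt) u (b ∷ rs) with b ≤ᵇ a
... | true  rewrite align-++ rt u rs       = refl
... | false rewrite align-++ (a ∷ rt) u rs = refl

align-alignPrefix : ∀ rt rs → let P = alignPrefix rt rs in
                    align rt rs ≡ (columns P ++ blank (unusedBottom P) , unusedTop P)
align-alignPrefix rt rs = begin
  align rt rs        ≡⟨ cong (λ t → align t rs) (sym (++-identityʳ rt)) ⟩
  align (rt ++ []) rs ≡⟨ align-++ rt [] rs ⟩
  (columns P ++ proj₁ (align [] (unusedBottom P)) , unusedTop P ++ proj₂ (align [] (unusedBottom P)))
    ≡⟨ cong (λ A → columns P ++ proj₁ A , unusedTop P ++ proj₂ A) (align-[] (unusedBottom P)) ⟩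
  (columns P ++ blank (unusedBottom P) , unusedTop P ++ [])
    ≡⟨ cong (columns P ++ blank (unusedBottom P) ,_) (++-identityʳ (unusedTop P)) ⟩
  (columns P ++ blank (unusedBottom P) , unusedTop P) ∎
  where
  open ≡-Reasoning
  P = alignPrefix rt rs

alignPrefix-exhausts : ∀ rt rs → unusedTop (alignPrefix rt rs) ≡ [] ⊎ unusedBottom (alignPrefix rt rs) ≡ []
alignPrefix-exhausts rt       []       = inj₂ refl
alignPrefix-exhausts []       (b ∷ rs) = inj₁ refl
alignPrefix-exhausts (a ∷ rt) (b ∷ rs) with b ≤ᵇ a
... | true  = alignPrefix-exhausts rt rs
... | false = alignPrefix-exhausts (a ∷ rt) rs

alignPrefix-bottom : ∀ rt rs → map proj₂ (columns (alignPrefix rt rs)) ++ unusedBottom (alignPrefix rt rs) ≡ rs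
alignPrefix-bottom rt       []       = refl
alignPrefix-bottom []       (b ∷ rs) = refl
alignPrefix-bottom (a ∷ rt) (b ∷ rs) with b ≤ᵇ a
... | true  = cong (b ∷_) (alignPrefix-bottom rt rs)
... | false = cong (b ∷_) (alignPrefix-bottom (a ∷ rt) rs)

alignPrefix-tops-above : ∀ {c} rt rs → All (c <_) rt → All (λ p → c < top p) (columns (alignPrefix rt rs))
alignPrefix-tops-above rt       []       _ = []
alignPrefix-tops-above []       (b ∷ rs) _ = []
alignPrefix-tops-above (a ∷ rt) (b ∷ rs) (c<a ∷ c<rt) with b ≤ᵇ a | ≤ᵇ-reflects-≤ b a
... | true  | _        = c<a ∷ alignPrefix-tops-above rt rs c<rt
... | false | ofⁿ b≰a = <-trans c<a (≰⇒> b≰a) ∷ alignPrefix-tops-above (a ∷ rt) rs (c<a ∷ c<rt)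

align-∷-≤ : ∀ {a b} rt rs → b ≤ a → align (a ∷ rt) (b ∷ rs) ≡ map₁ ((just a , b) ∷_) (align rt rs)
align-∷-≤ {a} {b} rt rs b≤a with b ≤ᵇ a | ≤ᵇ-reflects-≤ b a
... | true  | _        = refl
... | false | ofⁿ b≰a = contradiction b≤a b≰a

align-∷-> : ∀ {a b} rt rs → a < b → align (a ∷ rt) (b ∷ rs) ≡ map₁ ((nothing , b) ∷_) (align (a ∷ rt) rs)
align-∷-> {a} {b} rt rs a<b with b ≤ᵇ a | ≤ᵇ-reflects-≤ b a
... | true  | ofʸ b≤a = contradiction b≤a (<⇒≱ a<b)
... | false | _        = refl

data SingleAlignment (a : ℕ) (S : List ℕ) : Set where
  unmatched : All (a <_) S → align (a ∷ []) S ≡ (blank S , a ∷ []) → SingleAlignment a S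
  matched   : ∀ R b S₃ → S ≡ R ++ b ∷ S₃ → All (a <_) R → b ≤ a →
              align (a ∷ []) S ≡ (blank R ++ (just a , b) ∷ blank S₃ , []) → SingleAlignment a S

singleAlignment : ∀ a S → SingleAlignment a S
singleAlignment a []      = unmatched [] refl
singleAlignment a (b ∷ S) with b ≤? a
... | yes b≤a = matched [] b S refl [] b≤a (trans (align-∷-≤ [] S b≤a) (cong (map₁ ((just a , b) ∷_)) (align-[] S)))
... | no b≰a with singleAlignment a S
...   | unmatched a<S eq =
  unmatched (≰⇒> b≰a ∷ a<S) (trans (align-∷-> [] S (≰⇒> b≰a)) (cong (map₁ ((nothing , b) ∷_)) eq))
...   | matched R c S₃ refl a<R c≤a eq =
  matched (b ∷ R) c S₃ refl (≰⇒> b≰a ∷ a<R) c≤a (trans (align-∷-> [] S (≰⇒> b≰a)) (cong (map₁ ((nothing , b) ∷_)) eq))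

align-tops-below : ∀ {B} rt rs → All (_< B) rt → All (_< B) rs → All (_< B) (alignedTops (align rt rs))
align-tops-below rt       []       rt<B _ = rt<B
align-tops-below []       (b ∷ rs) _    rs<B rewrite align-[] rs | top-blank rs | ++-identityʳ rs = rs<B
align-tops-below (a ∷ rt) (b ∷ rs) (a<B ∷ rt<B) (b<B ∷ rs<B) with b ≤ᵇ a
... | true  = a<B ∷ align-tops-below rt rs rt<B rs<B
... | false = b<B ∷ align-tops-below (a ∷ rt) rs (a<B ∷ rt<B) rs<B

align-topRow-decreasing : ∀ rt rs → Linked _>_ rt → Linked _>_ rs → Linked _>_ (alignedTops (align rt rs))
align-topRow-decreasing rt       []       rt> _   = rt>
align-topRow-decreasing []       (b ∷ rs) _   rs> rewrite align-[] rs | top-blank rs | ++-identityʳ rs = rs>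
align-topRow-decreasing (a ∷ rt) (b ∷ rs) rt> rs> with b ≤ᵇ a | ≤ᵇ-reflects-≤ b a
... | true  | ofʸ b≤a =
  Linked-∷⁺ (align-tops-below rt rs (Linked-head-All (flip <-trans) rt>)
                              (All.map (λ c<b → <-≤-trans c<b b≤a) (Linked-head-All (flip <-trans) rs>)))
            (align-topRow-decreasing rt rs (Linked.tail rt>) (Linked.tail rs>))
... | false | ofⁿ b≰a =
  Linked-∷⁺ (align-tops-below (a ∷ rt) rs (a<b ∷ All.map (λ c<a → <-trans c<a a<b) (Linked-head-All (flip <-trans) rt>))
                              (Linked-head-All (flip <-trans) rs>))
            (align-topRow-decreasing (a ∷ rt) rs rt> (Linked.tail rs>))
  where a<b = ≰⇒> b≰a

reverse-++-∷ : ∀ {A : Set} (X : List A) p Z → reverse (X ++ p ∷ Z) ≡ reverse Z ++ p ∷ reverse X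
reverse-++-∷ X p Z = begin
  reverse (X ++ p ∷ Z)               ≡⟨ reverse-++ X (p ∷ Z) ⟩
  reverse (p ∷ Z) ++ reverse X       ≡⟨ cong (_++ reverse X) (unfold-reverse p Z) ⟩
  (reverse Z ++ p ∷ []) ++ reverse X ≡⟨ ++-assoc (reverse Z) (p ∷ []) (reverse X) ⟩
  reverse Z ++ p ∷ reverse X         ∎
  where open ≡-Reasoning

lift-fill : ∀ {a b} A R S₃ → All (λ p → a < top p) A → All (a <_) R → b ≤ a →
            Linked _<_ (reverse (map proj₂ A ++ R ++ b ∷ S₃)) →
            Linked _>_ (map top (A ++ blank (R ++ b ∷ S₃))) →
            Reduced (a ∷ liftAligned (A ++ blank (R ++ b ∷ S₃) , [])) →
            CKEquiv (liftAligned (A ++ blank R ++ (just a , b) ∷ blank S₃ , []))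
                    (a ∷ liftAligned (A ++ blank (R ++ b ∷ S₃) , []))
lift-fill {a} {b} A R S₃ a<A a<R b≤a σ-increasing tops-decreasing reduced =
  subst₂ CKEquiv (cong rows (sym new-columns)) (cong (λ Z → a ∷ rows Z) (sym old-columns))
    (rows-fill L Y L<b b≤a (Linked-∷⁺ a<W W-increasing)
               (subst (λ Z → Reduced (a ∷ rows Z)) old-columns reduced))
  where
  open ≡-Reasoning
  L   = reverse S₃
  Y   = reverse (A ++ blank R)
  old = A ++ blank (R ++ b ∷ S₃)
  reverse-columns : ∀ p → reverse ((A ++ blank R) ++ p ∷ blank S₃) ≡ blank L ++ p ∷ Y
  reverse-columns p = trans (reverse-++-∷ (A ++ blank R) p (blank S₃))
                            (cong (_++ p ∷ Y) (sym (reverse-map _ S₃)))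
  new-columns : reverse (A ++ blank R ++ (just a , b) ∷ blank S₃) ≡ blank L ++ (just a , b) ∷ Y
  new-columns = trans (cong reverse (sym (++-assoc A (blank R) _))) (reverse-columns (just a , b))
  old-columns : reverse old ≡ blank L ++ (nothing , b) ∷ Y
  old-columns = trans (cong reverse (trans (cong (A ++_) (map-++ _ R (b ∷ S₃))) (sym (++-assoc A (blank R) _))))
                      (reverse-columns (nothing , b))
  σ-split : reverse (map proj₂ A ++ R ++ b ∷ S₃) ≡ (L ++ b ∷ []) ++ reverse (map proj₂ A ++ R)
  σ-split = begin
    reverse (map proj₂ A ++ R ++ b ∷ S₃)        ≡⟨ cong reverse (sym (++-assoc (map proj₂ A) R _)) ⟩
    reverse ((map proj₂ A ++ R) ++ b ∷ S₃)      ≡⟨ reverse-++-∷ (map proj₂ A ++ R) b S₃ ⟩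
    L ++ b ∷ reverse (map proj₂ A ++ R)         ≡⟨ sym (++-assoc L _ _) ⟩
    (L ++ b ∷ []) ++ reverse (map proj₂ A ++ R) ∎
  L<b : Linked _<_ (L ++ b ∷ [])
  L<b = Linked-++⁻ˡ (L ++ b ∷ []) (subst (Linked _<_) σ-split σ-increasing)
  old-top-row : reverse (map top old) ≡ L ++ b ∷ map top Y
  old-top-row = begin
    reverse (map top old)                  ≡⟨ sym (reverse-map top old) ⟩
    map top (reverse old)                  ≡⟨ cong (map top) old-columns ⟩
    map top (blank L ++ (nothing , b) ∷ Y) ≡⟨ map-top-blank L _ ⟩
    L ++ b ∷ map top Y                     ∎
  W-increasing : Linked _<_ (map top Y)
  W-increasing = Linked.tail (Linked-++⁻ʳ L (subst (Linked _<_) old-top-row (Linked-reverse tops-decreasing)))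
  a<W : All (a <_) (map top Y)
  a<W = All.map⁺ (All-reverse (All.++⁺ a<A (All.map⁺ a<R)))

lift-∷-aligned : ∀ a A q S₂ → q ≡ [] ⊎ S₂ ≡ [] → All (λ p → a < top p) A →
                 Linked _<_ (reverse (map proj₂ A ++ S₂)) → Linked _>_ (map top (A ++ blank S₂) ++ q) →
                 Reduced (a ∷ liftAligned (A ++ blank S₂ , q)) →
                 CKEquiv (liftAligned (A ++ proj₁ (align (a ∷ []) S₂) , q ++ proj₂ (align (a ∷ []) S₂)))
                         (a ∷ liftAligned (A ++ blank S₂ , q))
lift-∷-aligned a A q S₂ exhausted a<A σ-increasing tops-decreasing reduced with singleAlignment a S₂
... | unmatched _ eq rewrite eq | reverse-++ q (a ∷ []) = ε
... | matched R b S₃ refl a<R b≤a eq rewrite eq with exhausted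
...   | inj₂ S₂≡[] = contradiction (++-conicalʳ R (b ∷ S₃) S₂≡[]) λ ()
...   | inj₁ refl  =
  lift-fill A R S₃ a<A a<R b≤a σ-increasing (subst (Linked _>_) (++-identityʳ _) tops-decreasing) reduced

lift-∷ : ∀ a τ σ → Linked _<_ (a ∷ τ) → Linked _<_ σ → Reduced (a ∷ lift τ σ) →
         CKEquiv (lift (a ∷ τ) σ) (a ∷ lift τ σ)
lift-∷ a τ σ aτ-increasing σ-increasing reduced =
  subst₂ CKEquiv (sym new) (cong (a ∷_) (sym old))
    (lift-∷-aligned a A q S₂ (alignPrefix-exhausts rt S) a<A σ-increasing′ tops-decreasing
                    (subst (λ w → Reduced (a ∷ w)) old reduced))
  where
  rt = reverse τ
  S  = reverse σ
  P  = alignPrefix rt S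
  A  = columns P
  q  = unusedTop P
  S₂ = unusedBottom P
  old : lift τ σ ≡ liftAligned (A ++ blank S₂ , q)
  old = trans (lift-liftAligned τ σ) (cong liftAligned (align-alignPrefix rt S))
  new : lift (a ∷ τ) σ ≡ liftAligned (A ++ proj₁ (align (a ∷ []) S₂) , q ++ proj₂ (align (a ∷ []) S₂))
  new = trans (lift-liftAligned (a ∷ τ) σ)
              (cong liftAligned (trans (cong (λ t → align t S) (unfold-reverse a τ)) (align-++ rt (a ∷ []) S)))
  a<A : All (λ p → a < top p) A
  a<A = alignPrefix-tops-above rt S (All-reverse (Linked-<-All aτ-increasing))
  σ-increasing′ : Linked _<_ (reverse (map proj₂ A ++ S₂))
  σ-increasing′ = subst (Linked _<_) (trans (sym (reverse-involutive σ)) (cong reverse (sym (alignPrefix-bottom rt S))))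
                        σ-increasing
  tops-decreasing : Linked _>_ (map top (A ++ blank S₂) ++ q)
  tops-decreasing = subst (Linked _>_ ∘ alignedTops) (align-alignPrefix rt S)
                          (align-topRow-decreasing rt S (Linked-reverse (Linked.tail aτ-increasing))
                                                        (Linked-reverse σ-increasing))

lift-[] : ∀ σ → lift [] σ ≡ σ
lift-[] σ = begin
  lift [] σ                                    ≡⟨ lift-liftAligned [] σ ⟩
  liftAligned (align [] (reverse σ))           ≡⟨ cong liftAligned (align-[] (reverse σ)) ⟩
  rows (reverse (blank (reverse σ)))
    ≡⟨ cong rows (trans (sym (reverse-map _ (reverse σ))) (cong blank (reverse-involutive σ))) ⟩
  map top (blank σ) ++ bottomRow (blank σ)     ≡⟨ cong₂ _++_ (top-blank σ) (bottomRow-blank σ) ⟩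
  σ ++ []                                      ≡⟨ ++-identityʳ σ ⟩
  σ                                            ∎
  where open ≡-Reasoning

lift-CK : ∀ τ σ → Linked _<_ τ → Linked _<_ σ → Reduced (τ ++ σ) → CKEquiv (lift τ σ) (τ ++ σ)
lift-CK []      σ _ _ _ = subst (λ w → CKEquiv w σ) (sym (lift-[] σ)) ε
lift-CK (a ∷ τ) σ aτ-increasing σ-increasing reduced =
  lift-∷ a τ σ aτ-increasing σ-increasing (Reduced-respects-CK (CK-∷ a (EqClosure.symmetric _ IH)) reduced)
  ◅◅ CK-∷ a IH
  where
  IH : CKEquiv (lift τ σ) (τ ++ σ)
  IH = lift-CK τ σ (Linked.tail aτ-increasing) σ-increasing (Reduced-tail a (τ ++ σ) reduced)

lemma4p18 : (τ σ : List ℕ) →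
    All (1 ≤_) τ → All (1 ≤_) σ →
    Linked _<_ τ → Linked _<_ σ →
    Reduced (τ ++ σ) →
    CKEquiv (lift τ σ) (τ ++ σ)
-- The letters need not be positive.
lemma4p18 τ σ _ _ = lift-CK τ σ
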